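{- Every uniquely $p$-colorable graph $G$ is also uniquely $(p,p-1)$-colorable.
   Context: A graph $G$ is uniquely $p$-colorable if $\chi(G)=p$ and every proper $p$-coloring of $G$ induces the same partition of $V(G)$. All graphs are simple, connected and undirected; $N_G(v)$ is the open neighborhood, $d(v)=|N_G(v)|$, $\Delta$ the maximum degree. For a coloring $c$ and vertex set $S$, $c(S)=\{c(u):u\in S\}$. For integers $k>0$ and $0<r\le\Delta(G)$ with $r\le k$, a conditional $(k,r)$-coloring of $G$ is a surjective map $c:V(G)\to\{1,\dots,k\}$ such that (C1) $c(u)\ne c(v)$ whenever $uv\in E(G)$, and (C2) $|c(N_G(v))|\ge\min\{d(v),r\}$ for every vertex $v$. $\chi_r(G)$ is the smallest $k$ for which $G$ has a conditional $(k,r)$-coloring. $G$ is uniquely $(k,r)$-colorable if $\chi_r(G)=k$ and every conditional $(k,r)$-coloring of $G$ induces the same partition of $V(G)$ into color classes. -}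

module Defs where

open import Data.Nat using (ℕ; zero; suc; _+_; _≤_; _<_; _⊓_)
open import Data.Fin using (Fin; zero; suc; _≟_)
open import Data.Bool using (Bool; true; false; _∧_; _∨_; if_then_else_)
open import Data.Product using (Σ; ∃; _×_; _,_)
open import Relation.Binary.PropositionalEquality using (_≡_; _≢_)
open import Relation.Nullary.Decidable using (⌊_⌋)
open import Function.Bundles using (_⇔_)
open import Relation.Nullary using (¬_)

record Graph (n : ℕ) : Set where
  field
    adj    : Fin n → Fin n → Bool
    sym    : ∀ u v → adj u v ≡ adj v u
    irrefl : ∀ v → adj v v ≡ false
open Graph public

countFin : ∀ {m} → (Fin m → Bool) → ℕ
countFin {zero}  f = 0
countFin {suc m} f = (if f zero then 1 else 0) + countFin (λ i → f (suc i))

anyFin : ∀ {m} → (Fin m → Bool) → Bool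
anyFin {zero}  f = false
anyFin {suc m} f = f zero ∨ anyFin (λ i → f (suc i))

data Walk {n} (G : Graph n) : Fin n → Fin n → Set where
  here : ∀ {v} → Walk G v v
  step : ∀ {u v w} → adj G u v ≡ true → Walk G v w → Walk G u w

Connected : ∀ {n} → Graph n → Set
Connected {n} G = ∀ (u v : Fin n) → Walk G u v

degree : ∀ {n} → Graph n → Fin n → ℕ
degree G v = countFin (adj G v)

Proper : ∀ {n k} → Graph n → (Fin n → Fin k) → Set
Proper {n} G c = ∀ (u v : Fin n) → adj G u v ≡ true → c u ≢ c v

Surjective : ∀ {n k} → (Fin n → Fin k) → Set
Surjective {n} {k} c = ∀ (i : Fin k) → ∃ λ (v : Fin n) → c v ≡ i

nbColours : ∀ {n k} → Graph n → (Fin n → Fin k) → Fin n → ℕ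
nbColours G c v = countFin (λ i → anyFin (λ u → adj G v u ∧ ⌊ c u ≟ i ⌋))

ChromaticNumber : ∀ {n} → Graph n → ℕ → Set
ChromaticNumber {n} G p =
  (Σ (Fin n → Fin p) λ c → Proper G c) ×
  (∀ k → k < p → ¬ (Σ (Fin n → Fin k) λ c → Proper G c))

SamePartition : ∀ {n k k'} → (Fin n → Fin k) → (Fin n → Fin k') → Set
SamePartition {n} c c' = ∀ (u v : Fin n) → (c u ≡ c v) ⇔ (c' u ≡ c' v)

UniquelyColourable : ∀ {n} → Graph n → ℕ → Set
UniquelyColourable {n} G p =
  ChromaticNumber G p ×
  (∀ (c c' : Fin n → Fin p) → Proper G c → Proper G c' → SamePartition c c')

IsConditionalColouring : ∀ {n k} → Graph n → ℕ → (Fin n → Fin k) → Set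
IsConditionalColouring {n} G r c =
  Surjective c × Proper G c ×
  (∀ (v : Fin n) → (degree G v ⊓ r) ≤ nbColours G c v)

ConditionalChromaticNumber : ∀ {n} → Graph n → ℕ → ℕ → Set
ConditionalChromaticNumber {n} G r k =
  (Σ (Fin n → Fin k) λ c → IsConditionalColouring G r c) ×
  (∀ k' → k' < k → ¬ (Σ (Fin n → Fin k') λ c → IsConditionalColouring G r c))

UniquelyConditionalColourable : ∀ {n} → Graph n → ℕ → ℕ → Set
UniquelyConditionalColourable {n} G k r =
  ConditionalChromaticNumber G r k ×
  (∀ (c c' : Fin n → Fin k) →
     IsConditionalColouring G r c → IsConditionalColouring G r c' →
     SamePartition c c')

-- In a uniquely p-colourable graph every proper p-colouring c is surjective (else χ < p),
-- and every vertex v sees all p − 1 colours other than c v on its neighbours: if some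
-- colour j ≠ c v were missing, recolouring v with j would give a proper p-colouring that
-- puts v into the class of a vertex coloured j, contradicting uniqueness. Hence c satisfies
-- (C2) for r = p − 1, and since conditional colourings are proper, χ_{p−1} = p and the
-- uniqueness of the partition carry over.
module Submission where

open import Defs hiding (sym)
open import Data.Nat using (ℕ; zero; suc; _≤_; _<_; _∸_; s≤s)
open import Data.Nat.Properties using (≤-refl; ≤-reflexive; ≤-trans; m⊓n≤n; n≤1+n; m≤n+m∸n)
open import Data.Fin using (Fin; _≟_; punchOut)
open import Data.Fin.Properties using (suc-injective; punchOut-injective; any?)
open import Data.Vec.Functional using (updateAt)
open import Data.Vec.Functional.Properties using (updateAt-updates; updateAt-minimal)
open import Data.Bool using (Bool; true; false; _∧_)
open import Data.Bool.Properties using (¬-not)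
open import Data.Product using (Σ; _,_; proj₁; proj₂)
open import Function using (_∘_; const)
open import Function.Bundles using (Equivalence)
open import Relation.Binary.PropositionalEquality using (_≡_; _≢_; refl; sym; trans; cong)
open import Relation.Nullary using (¬_; yes; no; contradiction)
open import Relation.Nullary.Decidable using (⌊_⌋)

countFin-all : ∀ {m} (f : Fin m → Bool) → (∀ i → f i ≡ true) → countFin f ≡ m
countFin-all {zero}  f all = refl
countFin-all {suc m} f all rewrite all Fin.zero = cong suc (countFin-all (f ∘ Fin.suc) (all ∘ Fin.suc))

countFin-tail≤ : ∀ {m} (f : Fin (suc m) → Bool) → countFin (f ∘ Fin.suc) ≤ countFin f
countFin-tail≤ f with f Fin.zero
... | true  = n≤1+n _
... | false = ≤-refl

countFin-allBut : ∀ {m} (x : Fin m) (f : Fin m → Bool) →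
                  (∀ i → i ≢ x → f i ≡ true) → m ∸ 1 ≤ countFin f
countFin-allBut Fin.zero f allBut =
  ≤-trans (≤-reflexive (sym (countFin-all (f ∘ Fin.suc) (λ i → allBut (Fin.suc i) λ ()))))
          (countFin-tail≤ f)
countFin-allBut {suc m} (Fin.suc x) f allBut rewrite allBut Fin.zero (λ ()) =
  ≤-trans (m≤n+m∸n m 1)
          (s≤s (countFin-allBut x (f ∘ Fin.suc) λ i i≢x → allBut (Fin.suc i) (i≢x ∘ suc-injective)))

anyFin-false : ∀ {m} (f : Fin m → Bool) → anyFin f ≡ false → ∀ i → f i ≡ false
anyFin-false f none Fin.zero with f Fin.zero
... | false = refl
anyFin-false f none (Fin.suc i) with f Fin.zero
... | false = anyFin-false (f ∘ Fin.suc) none i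

neighbourColoured : ∀ {n k} → Graph n → (Fin n → Fin k) → Fin n → Fin k → Bool
neighbourColoured G c v j = anyFin (λ u → adj G v u ∧ ⌊ c u ≟ j ⌋)

module _ {n : ℕ} (G : Graph n) where

  no-neighbourColoured : ∀ {k} (c : Fin n → Fin k) v j →
    neighbourColoured G c v j ≡ false → ∀ u → adj G v u ≡ true → c u ≢ j
  no-neighbourColoured c v j none u vu cu≡j with anyFin-false _ none u
  ... | noColour rewrite vu | cu≡j with j ≟ j
  ...   | yes _   = contradiction noColour λ ()
  ...   | no j≢j = j≢j refl

  adj⇒≢ : ∀ {u v} → adj G u v ≡ true → u ≢ v
  adj⇒≢ {v} uv refl with trans (sym uv) (irrefl G v)
  ... | ()

  module Recolour {k} (c : Fin n → Fin k) (v : Fin n) (j : Fin k) where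

    recolour : Fin n → Fin k
    recolour = updateAt c v (const j)

    recolour-at : recolour v ≡ j
    recolour-at = updateAt-updates v c

    recolour-elsewhere : ∀ {u} → u ≢ v → recolour u ≡ c u
    recolour-elsewhere {u} u≢v = updateAt-minimal u v c u≢v

    recolour-proper : Proper G c → (∀ u → adj G v u ≡ true → c u ≢ j) → Proper G recolour
    recolour-proper proper free x y xy with x ≟ v | y ≟ v
    ... | yes refl | yes refl = contradiction refl (adj⇒≢ xy)
    ... | yes refl | no y≢v   = λ e →
      free y xy (trans (sym (recolour-elsewhere y≢v)) (trans (sym e) recolour-at))
    ... | no x≢v   | yes refl = λ e →
      free x (trans (Graph.sym G v x) xy) (trans (sym (recolour-elsewhere x≢v)) (trans e recolour-at))
    ... | no x≢v   | no y≢v   = λ e →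
      proper x y xy (trans (sym (recolour-elsewhere x≢v)) (trans e (recolour-elsewhere y≢v)))

  minimal-proper⇒surjective : ∀ {k} (c : Fin n → Fin k) → Proper G c →
    (∀ k' → k' < k → ¬ (Σ (Fin n → Fin k') λ c' → Proper G c')) → Surjective c
  minimal-proper⇒surjective {suc k} c proper minimal i with any? (λ v → c v ≟ i)
  ... | yes hit = hit
  ... | no miss = contradiction (c' , proper') (minimal k ≤-refl)
    where
      i≢c : ∀ v → i ≢ c v
      i≢c v i≡cv = miss (v , sym i≡cv)
      c' : Fin n → Fin k
      c' v = punchOut (i≢c v)
      proper' : Proper G c'
      proper' x y xy = proper x y xy ∘ punchOut-injective (i≢c x) (i≢c y)

  module _ {p : ℕ} (c : Fin n → Fin p) (proper : Proper G c) (surjective : Surjective c)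
           (unique : ∀ (c c' : Fin n → Fin p) → Proper G c → Proper G c' → SamePartition c c')
           where

    sees-other-colours : ∀ v j → j ≢ c v → neighbourColoured G c v j ≡ true
    sees-other-colours v j j≢cv = ¬-not (j≢cv ∘ sym ∘ cv≡j)
      where
        u : Fin n
        u = proj₁ (surjective j)
        cu≡j : c u ≡ j
        cu≡j = proj₂ (surjective j)
        u≢v : u ≢ v
        u≢v refl = j≢cv (sym cu≡j)
        open Recolour c v j
        cv≡j : neighbourColoured G c v j ≡ false → c v ≡ j
        cv≡j none = trans (Equivalence.from (unique c recolour proper proper' v u) same) cu≡j
          where
            proper' : Proper G recolour
            proper' = recolour-proper proper (no-neighbourColoured c v j none)
            same : recolour v ≡ recolour u
            same = trans recolour-at (sym (trans (recolour-elsewhere u≢v) cu≡j))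

    p∸1≤nbColours : ∀ v → p ∸ 1 ≤ nbColours G c v
    p∸1≤nbColours v = countFin-allBut (c v) (neighbourColoured G c v) (sees-other-colours v)

mainTheorem17 : ∀ {n : ℕ} (G : Graph n) (p : ℕ) → 2 ≤ p → Connected G →
    UniquelyColourable G p → UniquelyConditionalColourable G p (p ∸ 1)
mainTheorem17 G p _ _ (((c , proper) , minimal) , unique) =
  ((c , conditional) , λ k k<p (c' , _ , proper' , _) → minimal k k<p (c' , proper')) ,
  λ c₁ c₂ (_ , proper₁ , _) (_ , proper₂ , _) → unique c₁ c₂ proper₁ proper₂
  where
    surjective : Surjective c
    surjective = minimal-proper⇒surjective G c proper minimal
    conditional : IsConditionalColouring G (p ∸ 1) c
    conditional = surjective , proper ,
      λ v → ≤-trans (m⊓n≤n _ _) (p∸1≤nbColours G c proper surjective unique v)
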